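{- Let $\Lambda$ be a restorative similarity type and let $\mathfrak{M}=\langle W,R,\{P_k\}_{k\in K}\rangle$ be an image-finite Kripke model. Let $S\subseteq W\times W$ be the subsumption relation, i.e. $(w,v)\in S$ iff for every $\varphi\in\mathcal{L}_\Lambda$, $\mathfrak{M},w\Vdash\varphi$ implies $\mathfrak{M},v\Vdash\varphi$. Then $S$ satisfies condition (Sim$\star$) for each $\star\in\Lambda$.
   Context: A Kripke model is image-finite if $R[w]=\{v\in W: wRv\}$ is finite for every $w\in W$. Fix a set $K$ of indices for propositional letters $p_k$. Consider six unary connectives $\smile,\frown,\circ_\smile,\circ_\frown,\bullet_\smile,\bullet_\frown$. A restorative similarity type is any subset $\Lambda\subseteq\{\smile,\frown,\circ_\smile,\circ_\frown,\bullet_\smile,\bullet_\frown\}$. The language $\mathcal{L}_\Lambda$ is generated by $\phi::=p_k\mid\top\mid\bot\mid\phi\wedge\phi\mid\phi\vee\phi\mid\star\phi$ with $k\in K$, $\star\in\Lambda$. A Kripke model is $\mathfrak{M}=\langle W,R,\{P_k\}_{k\in K}\rangle$ with $W$ nonempty, $R\subseteq W\times W$, each $P_k\subseteq W$. Satisfaction: $w\Vdash p_k$ iff $w\in P_k$; $\top$ true everywhere, $\bot$ nowhere; $\wedge,\vee$ classical; $w\Vdash\smile\phi$ iff some $v$ with $wRv$ has $v\not\Vdash\phi$; $w\Vdash\frown\phi$ iff every $v$ with $wRv$ has $v\not\Vdash\phi$; $w\Vdash\circ_\smile\phi$ iff $w\not\Vdash\phi$ or every $v$ with $wRv$ has $v\Vdash\phi$;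 $w\Vdash\circ_\frown\phi$ iff $w\Vdash\phi$ or every $v$ with $wRv$ has $v\not\Vdash\phi$; $w\Vdash\bullet_\smile\phi$ iff $w\Vdash\phi$ and some $v$ with $wRv$ has $v\not\Vdash\phi$; $w\Vdash\bullet_\frown\phi$ iff $w\not\Vdash\phi$ and some $v$ with $wRv$ has $v\Vdash\phi$. The conditions on a relation $S\subseteq W\times W$ (worlds range over $W$): (Sim$\smile$) if $(w,v)\in S$ and $wRs$ then there is $t$ with $vRt$ and $(t,s)\in S$; (Sim$\frown$) if $(w,v)\in S$ and $vRt$ then there is $s$ with $wRs$ and $(t,s)\in S$; (Sim$\circ_\smile$) if $(w,v)\in S$ and $vRt$ then either $(v,t)\in S$, or both $(v,w)\in S$ and there is $s$ with $wRs$ and $(s,t)\in S$; (Sim$\circ_\frown$) if $(w,v)\in S$ and $vRt$ then either $(t,v)\in S$, or there is $s$ with $wRs$ and $(t,s)\in S$; (Sim$\bullet_\smile$) if $(w,v)\in S$ and $wRs$ then either $(w,s)\in S$, or there is $t$ with $vRt$ and $(t,s)\in S$; (Sim$\bullet_\frown$) if $(w,v)\in S$ and $wRs$ then either $(s,w)\in S$, or both $(v,w)\in S$ and there is $t$ with $vRt$ and $(s,t)\in S$. -}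

module Defs where

open import Data.List using (List)
open import Data.List.Membership.Propositional using (_∈_)
open import Data.Product using (Σ; ∃; _×_; _,_)
open import Data.Sum using (_⊎_)
open import Relation.Nullary using (¬_)
open import Data.Unit using (⊤)
open import Data.Empty using (⊥)

data Conn : Set where
  ⌣ ⌢ ∘⌣ ∘⌢ •⌣ •⌢ : Conn

data Fm (K : Set) (Λ : Conn → Set) : Set where
  var  : K → Fm K Λ
  top  : Fm K Λ
  bot  : Fm K Λ
  _∧_  : Fm K Λ → Fm K Λ → Fm K Λ
  _∨_  : Fm K Λ → Fm K Λ → Fm K Λ
  op   : (c : Conn) → Λ c → Fm K Λ → Fm K Λ

record Model (K : Set) : Set₁ where
  field
    W     : Set
    R     : W → W → Set
    P     : K → W → Set
    world : W          -- witnesses that W is nonempty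

module _ {K : Set} (M : Model K) where
  open Model M

  ImageFinite : Set
  ImageFinite = ∀ w → Σ (List W) λ xs → ∀ v → (R w v → v ∈ xs) × (v ∈ xs → R w v)

  sat : {Λ : Conn → Set} → W → Fm K Λ → Set
  sat w (var k) = P k w
  sat w top = ⊤
  sat w bot = ⊥
  sat w (φ ∧ ψ) = sat w φ × sat w ψ
  sat w (φ ∨ ψ) = sat w φ ⊎ sat w ψ
  sat w (op ⌣ _ φ)  = ∃ λ v → R w v × ¬ sat v φ
  sat w (op ⌢ _ φ)  = ∀ v → R w v → ¬ sat v φ
  sat w (op ∘⌣ _ φ) = ¬ sat w φ ⊎ (∀ v → R w v → sat v φ)
  sat w (op ∘⌢ _ φ) = sat w φ ⊎ (∀ v → R w v → ¬ sat v φ)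
  sat w (op •⌣ _ φ) = sat w φ × (∃ λ v → R w v × ¬ sat v φ)
  sat w (op •⌢ _ φ) = ¬ sat w φ × (∃ λ v → R w v × sat v φ)

  Subsumption : (Λ : Conn → Set) → W → W → Set
  Subsumption Λ w v = (φ : Fm K Λ) → sat w φ → sat v φ

  Sim : Conn → (W → W → Set) → Set
  Sim ⌣ S = ∀ w v s → S w v → R w s → ∃ λ t → R v t × S t s
  Sim ⌢ S = ∀ w v t → S w v → R v t → ∃ λ s → R w s × S t s
  Sim ∘⌣ S = ∀ w v t → S w v → R v t →
               S v t ⊎ (S v w × (∃ λ s → R w s × S s t))
  Sim ∘⌢ S = ∀ w v t → S w v → R v t →
               S t v ⊎ (∃ λ s → R w s × S t s)
  Sim •⌣ S = ∀ w v s → S w v → R w s →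
               S w s ⊎ (∃ λ t → R v t × S t s)
  Sim •⌢ S = ∀ w v s → S w v → R w s →
               S s w ⊎ (S v w × (∃ λ t → R v t × S s t))

{-# OPTIONS --safe #-}
module Submission where

-- Classically, v fails to subsume w exactly when some formula holds at w and fails at v.
-- By image-finiteness, the finitely many formulas separating the successors of a world
-- from a given world combine into a single disjunction (or conjunction).  Applying the
-- connective ⋆ to such a formula, possibly combined with one separating the two worlds at
-- hand, yields a formula true at w and false at v whenever (Sim ⋆) fails for (w , v).

open import Defs
open import Level using (0ℓ)
open import Axiom.ExcludedMiddle using (ExcludedMiddle)
open import Axiom.DoubleNegationElimination using (em⇒dne)
open import Data.List using (List; []; _∷_)
open import Data.List.Membership.Propositional using (_∈_)
open import Data.List.Relation.Unary.All as All using (All; []; _∷_)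
open import Data.Product using (∃; _×_; _,_; proj₁; proj₂)
open import Data.Sum using (_⊎_; inj₁; inj₂; [_,_])
open import Data.Unit using (tt)
open import Function using (_∘_)
open import Relation.Nullary using (¬_; yes; no)

module _ (em : ExcludedMiddle 0ℓ) {K : Set} {Λ : Conn → Set} (M : Model K) where
  open Model M

  _⊩_ : W → Fm K Λ → Set
  w ⊩ φ = sat M w φ

  _≼_ : W → W → Set
  _≼_ = Subsumption M Λ

  separating-formula : ∀ {x y} → ¬ x ≼ y → ∃ λ φ → x ⊩ φ × ¬ y ⊩ φ
  separating-formula x⋠y = em⇒dne em λ none →
    x⋠y λ φ x⊩φ → em⇒dne em λ y⊮φ → none (φ , x⊩φ , y⊮φ)

  subsumed-or-separated : ∀ x y → x ≼ y ⊎ ∃ λ φ → x ⊩ φ × ¬ y ⊩ φ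
  subsumed-or-separated x y with em {x ≼ y}
  ... | yes x≼y = inj₁ x≼y
  ... | no  x⋠y = inj₂ (separating-formula x⋠y)

  ⋁-separator : ∀ {s} xs → All (λ x → ¬ x ≼ s) xs →
                ∃ λ ψ → All (_⊩ ψ) xs × ¬ s ⊩ ψ
  ⋁-separator []       []              = bot , [] , λ ()
  ⋁-separator (x ∷ xs) (x⋠s ∷ xs⋠s)
    with separating-formula x⋠s | ⋁-separator xs xs⋠s
  ... | φ , x⊩φ , s⊮φ | ψ , xs⊩ψ , s⊮ψ =
    φ ∨ ψ , inj₁ x⊩φ ∷ All.map inj₂ xs⊩ψ , [ s⊮φ , s⊮ψ ]

  ⋀-separator : ∀ {s} xs → All (λ x → ¬ s ≼ x) xs →
                ∃ λ ψ → s ⊩ ψ × All (λ x → ¬ x ⊩ ψ) xs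
  ⋀-separator []       []              = top , tt , []
  ⋀-separator (x ∷ xs) (s⋠x ∷ s⋠xs)
    with separating-formula s⋠x | ⋀-separator xs s⋠xs
  ... | φ , s⊩φ , x⊮φ | ψ , s⊩ψ , xs⊮ψ =
    φ ∧ ψ , (s⊩φ , s⊩ψ) , (x⊮φ ∘ proj₁) ∷ All.map (_∘ proj₂) xs⊮ψ

  module _ (image-finite : ImageFinite M) where

    successors : W → List W
    successors u = proj₁ (image-finite u)

    ∈-successors : ∀ {u t} → R u t → t ∈ successors u
    ∈-successors {u} {t} = proj₁ (proj₂ (image-finite u) t)

    successors-⊆ : ∀ {u t} → t ∈ successors u → R u t
    successors-⊆ {u} {t} = proj₂ (proj₂ (image-finite u) t)

    successor-subsumed : ∀ u s →
      (∀ ψ → ¬ s ⊩ ψ → ¬ (∀ t → R u t → t ⊩ ψ)) → ∃ λ t → R u t × t ≼ s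
    successor-subsumed u s refute = em⇒dne em λ none →
      let ψ , succ⊩ψ , s⊮ψ = ⋁-separator (successors u)
            (All.tabulate λ t∈ t≼s → none (_ , successors-⊆ t∈ , t≼s))
      in refute ψ s⊮ψ λ t Rut → All.lookup succ⊩ψ (∈-successors Rut)

    successor-subsuming : ∀ u t →
      (∀ ψ → t ⊩ ψ → ¬ (∀ s → R u s → ¬ s ⊩ ψ)) → ∃ λ s → R u s × t ≼ s
    successor-subsuming u t refute = em⇒dne em λ none →
      let ψ , t⊩ψ , succ⊮ψ = ⋀-separator (successors u)
            (All.tabulate λ s∈ t≼s → none (_ , successors-⊆ s∈ , t≼s))
      in refute ψ t⊩ψ λ s Rus → All.lookup succ⊮ψ (∈-successors Rus)

    sim-⌣ : Λ ⌣ → Sim M ⌣ _≼_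
    sim-⌣ l w v s w≼v Rws = successor-subsumed v s λ ψ s⊮ψ succ⊩ψ →
      let t , Rvt , t⊮ψ = w≼v (op ⌣ l ψ) (s , Rws , s⊮ψ)
      in t⊮ψ (succ⊩ψ t Rvt)

    sim-⌢ : Λ ⌢ → Sim M ⌢ _≼_
    sim-⌢ l w v t w≼v Rvt = successor-subsuming w t λ ψ t⊩ψ succ⊮ψ →
      w≼v (op ⌢ l ψ) succ⊮ψ t Rvt t⊩ψ

    sim-∘⌣ : Λ ∘⌣ → Sim M ∘⌣ _≼_
    sim-∘⌣ l w v t w≼v Rvt with subsumed-or-separated v t
    ... | inj₁ v≼t = inj₁ v≼t
    ... | inj₂ (φ , v⊩φ , t⊮φ) = inj₂ (v≼w , successor-subsumed w t below-t)
      where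
      v⊮∘⌣ : ∀ ψ → v ⊩ ψ → ¬ t ⊩ ψ → ¬ v ⊩ op ∘⌣ l ψ
      v⊮∘⌣ ψ v⊩ψ t⊮ψ = [ (λ v⊮ψ → v⊮ψ v⊩ψ) , (λ succ⊩ψ → t⊮ψ (succ⊩ψ t Rvt)) ]

      v≼w : v ≼ w
      v≼w ψ v⊩ψ = em⇒dne em λ w⊮ψ →
        v⊮∘⌣ (φ ∧ ψ) (v⊩φ , v⊩ψ) (t⊮φ ∘ proj₁) (w≼v (op ∘⌣ l (φ ∧ ψ)) (inj₁ (w⊮ψ ∘ proj₂)))

      below-t : ∀ ψ → ¬ t ⊩ ψ → ¬ (∀ s → R w s → s ⊩ ψ)
      below-t ψ t⊮ψ succ⊩ψ =
        v⊮∘⌣ (φ ∨ ψ) (inj₁ v⊩φ) [ t⊮φ , t⊮ψ ]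
          (w≼v (op ∘⌣ l (φ ∨ ψ)) (inj₂ λ s Rws → inj₂ (succ⊩ψ s Rws)))

    sim-∘⌢ : Λ ∘⌢ → Sim M ∘⌢ _≼_
    sim-∘⌢ l w v t w≼v Rvt with subsumed-or-separated t v
    ... | inj₁ t≼v = inj₁ t≼v
    ... | inj₂ (φ , t⊩φ , v⊮φ) = inj₂ (successor-subsuming w t λ ψ t⊩ψ succ⊮ψ →
      [ v⊮φ ∘ proj₁ , (λ succ⊮φ∧ψ → succ⊮φ∧ψ t Rvt (t⊩φ , t⊩ψ)) ]
        (w≼v (op ∘⌢ l (φ ∧ ψ)) (inj₂ λ s Rws → succ⊮ψ s Rws ∘ proj₂)))

    sim-•⌣ : Λ •⌣ → Sim M •⌣ _≼_
    sim-•⌣ l w v s w≼v Rws with subsumed-or-separated w s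
    ... | inj₁ w≼s = inj₁ w≼s
    ... | inj₂ (φ , w⊩φ , s⊮φ) = inj₂ (successor-subsumed v s λ ψ s⊮ψ succ⊩ψ →
      let _ , t , Rvt , t⊮φ∨ψ = w≼v (op •⌣ l (φ ∨ ψ)) (inj₁ w⊩φ , s , Rws , [ s⊮φ , s⊮ψ ])
      in t⊮φ∨ψ (inj₂ (succ⊩ψ t Rvt)))

    sim-•⌢ : Λ •⌢ → Sim M •⌢ _≼_
    sim-•⌢ l w v s w≼v Rws with subsumed-or-separated s w
    ... | inj₁ s≼w = inj₁ s≼w
    ... | inj₂ (φ , s⊩φ , w⊮φ) = inj₂ (v≼w , successor-subsuming v s above-s)
      where
      v≼w : v ≼ w
      v≼w ψ v⊩ψ = em⇒dne em λ w⊮ψ →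
        proj₁ (w≼v (op •⌢ l (φ ∨ ψ)) ([ w⊮φ , w⊮ψ ] , s , Rws , inj₁ s⊩φ)) (inj₂ v⊩ψ)

      above-s : ∀ ψ → s ⊩ ψ → ¬ (∀ t → R v t → ¬ t ⊩ ψ)
      above-s ψ s⊩ψ succ⊮ψ =
        let _ , t , Rvt , t⊩φ∧ψ = w≼v (op •⌢ l (φ ∧ ψ)) (w⊮φ ∘ proj₁ , s , Rws , (s⊩φ , s⊩ψ))
        in succ⊮ψ t Rvt (proj₂ t⊩φ∧ψ)

lemma6p3 : ExcludedMiddle 0ℓ →
    (K : Set) (Λ : Conn → Set) (M : Model K) → ImageFinite M →
    (c : Conn) → Λ c → Sim M c (Subsumption M Λ)
lemma6p3 em K Λ M image-finite ⌣  = sim-⌣  em M image-finite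
lemma6p3 em K Λ M image-finite ⌢  = sim-⌢  em M image-finite
lemma6p3 em K Λ M image-finite ∘⌣ = sim-∘⌣ em M image-finite
lemma6p3 em K Λ M image-finite ∘⌢ = sim-∘⌢ em M image-finite
lemma6p3 em K Λ M image-finite •⌣ = sim-•⌣ em M image-finite
lemma6p3 em K Λ M image-finite •⌢ = sim-•⌢ em M image-finite
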